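{- Write $\Theta_n=\{\phi_1,\dots,\phi_s\}$ and for $k=1,\dots,m$ let $I_k,J_k\subseteq\{1,\dots,s\}$ and $r_k=\frac{\bigvee_{i\in I_k}\phi_i\vee\bigvee_{j\in J_k}\phi_j}{\bigvee_{j\in J_k}\phi_j}$. Then a substitution $\sigma$ rejects each of $r_1,\dots,r_m$ in $S4$ iff there is a set $W$ with $W\subseteq\{\phi_i\in\Theta_n\mid i\in I_k\cup J_k\}$ for every $k=1,\dots,m$, such that the same $\sigma$ rejects each of the rules $r'_k=\frac{\bigvee_{\phi_i\in W}\phi_i}{\bigvee_{j\in J_k}\phi_j}$, $k=1,\dots,m$.
   Context: $S4$ is the normal modal logic with axioms $K$, $T:\Box A\to A$, $4:\Box A\to\Box\Box A$ and necessitation; $\diamond=\neg\Box\neg$. A substitution $\sigma$ rejects a rule $\frac{\alpha}{\beta}$ if $\vdash_{S4}\sigma(\alpha)$ and $\nvdash_{S4}\sigma(\beta)$. Fix variables $p_1,\dots,p_n$; $\alpha^1=\alpha$, $\alpha^0=\neg\alpha$. $\Theta_n$ is the set of all disjuncts $\bigwedge_{i=1}^n p_i^{t(i,0)}\wedge\bigwedge_{i=1}^n(\diamond p_i)^{t(i,1)}$ for functions $t:\{1,\dots,n\}\times\{0,1\}\to\{0,1\}$. -}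

module Defs where

open import Data.Nat using (ℕ; zero; suc)
open import Data.Bool using (Bool; true; false; not; _∧_; _∨_; T)
open import Data.Fin using (Fin; toℕ)
open import Data.Vec using (Vec; []; _∷_; lookup)
open import Data.List using (List; []; _∷_; map; foldr; concatMap; filterᵇ)
open import Data.Product using (_×_; _,_; proj₁; proj₂)
open import Relation.Nullary using (¬_)

infixr 6 _∧'_
infixr 5 _∨'_
infixr 4 _⇒_
data Fm : Set where
  var  : ℕ → Fm
  ⊥'   : Fm
  ¬'_  : Fm → Fm
  _∧'_ : Fm → Fm → Fm
  _∨'_ : Fm → Fm → Fm
  _⇒_  : Fm → Fm → Fm
  □_   : Fm → Fm

⊤' : Fm
⊤' = ¬' ⊥'

◇_ : Fm → Fm
◇ A = ¬' (□ (¬' A))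

-- Propositional evaluation: variables via v, boxed formulas □A treated as atoms via b.
eval : (ℕ → Bool) → (Fm → Bool) → Fm → Bool
eval v b (var i) = v i
eval v b ⊥' = false
eval v b (¬' A) = not (eval v b A)
eval v b (A ∧' B) = eval v b A ∧ eval v b B
eval v b (A ∨' B) = eval v b A ∨ eval v b B
eval v b (A ⇒ B) = not (eval v b A) ∨ eval v b B
eval v b (□ A) = b A

-- Substitution instances of classical tautologies
Taut : Fm → Set
Taut A = (v : ℕ → Bool) (b : Fm → Bool) → T (eval v b A)

data ⊢S4 : Fm → Set where
  taut : ∀ {A} → Taut A → ⊢S4 A
  axK  : ∀ {A B} → ⊢S4 (□ (A ⇒ B) ⇒ (□ A ⇒ □ B))
  axT  : ∀ {A} → ⊢S4 (□ A ⇒ A)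
  ax4  : ∀ {A} → ⊢S4 (□ A ⇒ □ (□ A))
  mp   : ∀ {A B} → ⊢S4 (A ⇒ B) → ⊢S4 A → ⊢S4 B
  nec  : ∀ {A} → ⊢S4 A → ⊢S4 (□ A)

Subst : Set
Subst = ℕ → Fm

sub : Subst → Fm → Fm
sub σ (var i) = σ i
sub σ ⊥' = ⊥'
sub σ (¬' A) = ¬' sub σ A
sub σ (A ∧' B) = sub σ A ∧' sub σ B
sub σ (A ∨' B) = sub σ A ∨' sub σ B
sub σ (A ⇒ B) = sub σ A ⇒ sub σ B
sub σ (□ A) = □ sub σ A

Rejects : Subst → Fm → Fm → Set
Rejects σ α β = ⊢S4 (sub σ α) × ¬ ⊢S4 (sub σ β)

lit : Bool → Fm → Fm
lit true A = A
lit false A = ¬' A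

⋀ : List Fm → Fm
⋀ = foldr _∧'_ ⊤'

⋁ : List Fm → Fm
⋁ = foldr _∨'_ ⊥'

-- Index of a disjunct of Θ_n: a function t : {1..n}×{0,1} → {0,1},
-- represented as a vector whose i-th entry is (t(i,0), t(i,1)).
Idx : ℕ → Set
Idx n = Vec (Bool × Bool) n

finList : (n : ℕ) → List (Fin n)
finList zero = []
finList (suc n) = Fin.zero ∷ map Fin.suc (finList n)

φ : ∀ {n} → Idx n → Fm
φ {n} t = ⋀ (map (λ i → lit (proj₁ (lookup t i)) (var (toℕ i))) (finList n))
       ∧' ⋀ (map (λ i → lit (proj₂ (lookup t i)) (◇ var (toℕ i))) (finList n))

-- Enumeration of all indices (hence of Θ_n = {φ_1, …, φ_s})
allIdx : (n : ℕ) → List (Idx n)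
allIdx zero = [] ∷ []
allIdx (suc n) = concatMap (λ v → map (_∷ v) ((true , true) ∷ (true , false) ∷ (false , true) ∷ (false , false) ∷ [])) (allIdx n)

SubΘ : ℕ → Set
SubΘ n = Idx n → Bool

-- ⋁_{φ_i ∈ X} φ_i  (empty disjunction = ⊥)
⋁Θ : ∀ {n} → SubΘ n → Fm
⋁Θ {n} X = ⋁ (map φ (filterᵇ X (allIdx n)))

module Submission where

-- Under any Boolean valuation (v , b) of variables and boxed
-- formulas, exactly one disjunct of Θ_n is true: the one whose index records
-- the values of p_i and ◇p_i (its "profile").  Hence ⋁Θ X evaluates to
-- X (profile v b), so propositional reasoning about the formulas ⋁Θ X is
-- reasoning about the Boolean sets X at a single point.  Since substitution
-- commutes with evaluation, propositional tautologies stay tautologies under σ,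
-- and we get, for provability of σ-instances in S4:
--   * monotonicity   X ⊆ Y  and  ⊢ σ(⋁Θ X)  give  ⊢ σ(⋁Θ Y);
--   * union          ⋁Θ X ∨ ⋁Θ Y  and  ⋁Θ (X ∪ Y)  are interderivable;
--   * intersection   ⊢ σ(⋁Θ (X k)) for all k gives ⊢ σ(⋁Θ (⋂ X)).
-- The theorem follows: for "⇒" take W = ⋂_k (I_k ∪ J_k); for "⇐" use
-- W ⊆ I_k ∪ J_k with monotonicity and union.  Conclusions ⊬ σ(⋁Θ J_k) are
-- the same on both sides.

open import Defs
open import Data.Nat using (ℕ; zero; suc)
open import Data.Fin using (Fin; toℕ)
open import Data.Bool using (Bool; true; false; not; _∧_; _∨_; T)
open import Data.Product using (_×_; Σ; _,_; proj₁; proj₂)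
open import Data.Bool.Properties using (∧-conicalˡ; ∧-conicalʳ)
open import Data.Vec using ([]; _∷_; lookup; tabulate)
open import Data.Vec.Properties using (lookup∘tabulate; tabulate∘lookup; tabulate-cong)
open import Data.List using (List; []; _∷_; map; filterᵇ)
open import Data.List.Relation.Unary.Any using (Any; here; there)
open import Data.List.Membership.Propositional using (_∈_)
open import Data.List.Membership.Propositional.Properties using (∈-map⁺; ∈-concatMap⁺)
open import Relation.Binary.PropositionalEquality
  using (_≡_; refl; sym; trans; cong; cong₂; subst)
open import Function.Bundles using (_⇔_; mk⇔)

eval-sub : (v : ℕ → Bool) (b : Fm → Bool) (σ : Subst) (A : Fm) →
           eval v b (sub σ A) ≡ eval (λ i → eval v b (σ i)) (λ B → b (sub σ B)) A
eval-sub v b σ (var i) = refl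
eval-sub v b σ ⊥' = refl
eval-sub v b σ (¬' A) = cong not (eval-sub v b σ A)
eval-sub v b σ (A ∧' B) = cong₂ _∧_ (eval-sub v b σ A) (eval-sub v b σ B)
eval-sub v b σ (A ∨' B) = cong₂ _∨_ (eval-sub v b σ A) (eval-sub v b σ B)
eval-sub v b σ (A ⇒ B) = cong₂ (λ x y → not x ∨ y) (eval-sub v b σ A) (eval-sub v b σ B)
eval-sub v b σ (□ A) = refl

taut-sub : (σ : Subst) (A : Fm) → Taut A → Taut (sub σ A)
taut-sub σ A h v b = subst T (sym (eval-sub v b σ A)) (h _ _)

valid : (A : Fm) → (∀ v b → eval v b A ≡ true) → Taut A
valid A h v b with eval v b A | h v b
... | true | _ = _

consequence : (σ : Subst) (A B : Fm) →
              (∀ v b → eval v b A ≡ true → eval v b B ≡ true) →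
              ⊢S4 (sub σ A) → ⊢S4 (sub σ B)
consequence σ A B h = mp (taut (taut-sub σ (A ⇒ B) (valid (A ⇒ B) implication)))
  where
  implication : ∀ v b → eval v b (A ⇒ B) ≡ true
  implication v b with eval v b A | h v b
  ... | true  | hAB = hAB refl
  ... | false | _   = refl

consequence₂ : (σ : Subst) (A B C : Fm) →
               (∀ v b → eval v b A ≡ true → eval v b B ≡ true → eval v b C ≡ true) →
               ⊢S4 (sub σ A) → ⊢S4 (sub σ B) → ⊢S4 (sub σ C)
consequence₂ σ A B C h pA =
  mp (mp (taut (taut-sub σ (A ⇒ (B ⇒ C)) (valid (A ⇒ (B ⇒ C)) implication))) pA)
  where
  implication : ∀ v b → eval v b (A ⇒ (B ⇒ C)) ≡ true
  implication v b with eval v b A | eval v b B | h v b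
  ... | true  | true  | hABC = hABC refl refl
  ... | true  | false | _    = refl
  ... | false | _     | _    = refl

finList-complete : ∀ n (i : Fin n) → i ∈ finList n
finList-complete (suc n) Fin.zero = here refl
finList-complete (suc n) (Fin.suc i) = there (∈-map⁺ Fin.suc (finList-complete n i))

allIdx-complete : ∀ n (t : Idx n) → t ∈ allIdx n
allIdx-complete zero [] = here refl
allIdx-complete (suc n) (x ∷ t) = ∈-concatMap⁺ extensions (extend (allIdx-complete n t))
  where
  pairs : List (Bool × Bool)
  pairs = (true , true) ∷ (true , false) ∷ (false , true) ∷ (false , false) ∷ []
  extensions : Idx n → List (Idx (suc n))
  extensions w = map (_∷ w) pairs
  pairs-complete : ∀ p → p ∈ pairs
  pairs-complete (true , true) = here refl
  pairs-complete (true , false) = there (here refl)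
  pairs-complete (false , true) = there (there (here refl))
  pairs-complete (false , false) = there (there (there (here refl)))
  extend : ∀ {L} → t ∈ L → Any (λ w → (x ∷ t) ∈ extensions w) L
  extend (here refl) = here (∈-map⁺ (_∷ t) (pairs-complete x))
  extend (there m) = there (extend m)

module Valuation (v : ℕ → Bool) (b : Fm → Bool) where

  ⟦_⟧ : Fm → Bool
  ⟦ A ⟧ = eval v b A

  lit-true⇒ : ∀ x A → ⟦ lit x A ⟧ ≡ true → x ≡ ⟦ A ⟧
  lit-true⇒ true A p = sym p
  lit-true⇒ false A p with ⟦ A ⟧
  lit-true⇒ false A () | true
  lit-true⇒ false A p  | false = refl

  lit-true⇐ : ∀ A → ⟦ lit ⟦ A ⟧ A ⟧ ≡ true
  lit-true⇐ A with ⟦ A ⟧ in eq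
  ... | true  = eq
  ... | false = cong not eq

  ⋀-true⇒ : ∀ {X : Set} (f : X → Fm) (L : List X) → ⟦ ⋀ (map f L) ⟧ ≡ true →
            ∀ {x} → x ∈ L → ⟦ f x ⟧ ≡ true
  ⋀-true⇒ f (y ∷ L) p (here refl) = ∧-conicalˡ _ _ p
  ⋀-true⇒ f (y ∷ L) p (there m)   = ⋀-true⇒ f L (∧-conicalʳ _ _ p) m

  ⋀-true⇐ : ∀ {X : Set} (f : X → Fm) (L : List X) → (∀ x → ⟦ f x ⟧ ≡ true) →
            ⟦ ⋀ (map f L) ⟧ ≡ true
  ⋀-true⇐ f [] h = refl
  ⋀-true⇐ f (x ∷ L) h rewrite h x = ⋀-true⇐ f L h

  profile : ∀ {n} → Idx n
  profile = tabulate (λ i → (⟦ var (toℕ i) ⟧ , ⟦ ◇ var (toℕ i) ⟧))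

  φ-true⇒ : ∀ {n} (t : Idx n) → ⟦ φ t ⟧ ≡ true → t ≡ profile
  φ-true⇒ {n} t p = trans (sym (tabulate∘lookup t)) (tabulate-cong entry)
    where
    atoms = λ i → lit (proj₁ (lookup t i)) (var (toℕ i))
    diamonds = λ i → lit (proj₂ (lookup t i)) (◇ var (toℕ i))
    atoms-true : ⟦ ⋀ (map atoms (finList n)) ⟧ ≡ true
    atoms-true = ∧-conicalˡ _ _ p
    diamonds-true : ⟦ ⋀ (map diamonds (finList n)) ⟧ ≡ true
    diamonds-true = ∧-conicalʳ _ _ p
    entry : ∀ i → lookup t i ≡ (⟦ var (toℕ i) ⟧ , ⟦ ◇ var (toℕ i) ⟧)
    entry i = cong₂ _,_
      (lit-true⇒ _ _ (⋀-true⇒ atoms (finList n) atoms-true (finList-complete n i)))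
      (lit-true⇒ _ _ (⋀-true⇒ diamonds (finList n) diamonds-true (finList-complete n i)))

  profile-atoms : ∀ {n} (i : Fin n) →
                  ⟦ lit (proj₁ (lookup (profile {n}) i)) (var (toℕ i)) ⟧ ≡ true
  profile-atoms i rewrite lookup∘tabulate (λ i → (⟦ var (toℕ i) ⟧ , ⟦ ◇ var (toℕ i) ⟧)) i
    = lit-true⇐ (var (toℕ i))

  profile-diamonds : ∀ {n} (i : Fin n) →
                     ⟦ lit (proj₂ (lookup (profile {n}) i)) (◇ var (toℕ i)) ⟧ ≡ true
  profile-diamonds i rewrite lookup∘tabulate (λ i → (⟦ var (toℕ i) ⟧ , ⟦ ◇ var (toℕ i) ⟧)) i
    = lit-true⇐ (◇ var (toℕ i))

  φ-profile : ∀ {n} → ⟦ φ (profile {n}) ⟧ ≡ true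
  φ-profile {n}
    rewrite ⋀-true⇐ (λ i → lit (proj₁ (lookup (profile {n}) i)) (var (toℕ i))) (finList n) profile-atoms
    = ⋀-true⇐ _ (finList n) profile-diamonds

  module SingleTrue {X : Set} (f : X → Fm) (c : X)
                    (unique : ∀ x → ⟦ f x ⟧ ≡ true → x ≡ c) (S : X → Bool) where

    ⋁-filter-sound : ∀ L → ⟦ ⋁ (map f (filterᵇ S L)) ⟧ ≡ true → S c ≡ true
    ⋁-filter-sound (x ∷ L) p with S x in Sx
    ... | false = ⋁-filter-sound L p
    ... | true with ⟦ f x ⟧ in fx
    ...   | true  = trans (cong S (sym (unique x fx))) Sx
    ...   | false = ⋁-filter-sound L p

    ⋁-filter-complete : ∀ L → c ∈ L → S c ≡ true → ⟦ f c ⟧ ≡ true →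
                        ⟦ ⋁ (map f (filterᵇ S L)) ⟧ ≡ true
    ⋁-filter-complete (x ∷ L) (here refl) Sc fc rewrite Sc | fc = refl
    ⋁-filter-complete (x ∷ L) (there m) Sc fc with S x
    ... | false = ⋁-filter-complete L m Sc fc
    ... | true with ⟦ f x ⟧
    ...   | true  = refl
    ...   | false = ⋁-filter-complete L m Sc fc

  ⋁Θ-true⇒ : ∀ {n} (X : SubΘ n) → ⟦ ⋁Θ X ⟧ ≡ true → X profile ≡ true
  ⋁Θ-true⇒ {n} X = ⋁-filter-sound (allIdx n)
    where open SingleTrue φ profile φ-true⇒ X

  ⋁Θ-true⇐ : ∀ {n} (X : SubΘ n) → X profile ≡ true → ⟦ ⋁Θ X ⟧ ≡ true
  ⋁Θ-true⇐ {n} X Xp = ⋁-filter-complete (allIdx n) (allIdx-complete n profile) Xp (φ-profile {n})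
    where open SingleTrue φ profile φ-true⇒ X

  ⋁Θ-eval : ∀ {n} (X : SubΘ n) → ⟦ ⋁Θ X ⟧ ≡ X profile
  ⋁Θ-eval X with X profile in Xp
  ... | true = ⋁Θ-true⇐ X Xp
  ... | false with ⟦ ⋁Θ X ⟧ in value
  ...   | false = refl
  ...   | true  = trans (sym (⋁Θ-true⇒ X value)) Xp

open Valuation using (⋁Θ-eval; profile)

_∪_ : ∀ {n} → SubΘ n → SubΘ n → SubΘ n
(X ∪ Y) t = X t ∨ Y t

⋂ : ∀ {n} m → (Fin m → SubΘ n) → SubΘ n
⋂ zero X t = true
⋂ (suc m) X t = X Fin.zero t ∧ ⋂ m (λ k → X (Fin.suc k)) t

⋂-lower : ∀ {n} m (X : Fin m → SubΘ n) (k : Fin m) (t : Idx n) → ⋂ m X t ≡ true → X k t ≡ true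
⋂-lower (suc m) X Fin.zero t p = ∧-conicalˡ _ _ p
⋂-lower (suc m) X (Fin.suc k) t p = ⋂-lower m (λ k → X (Fin.suc k)) k t (∧-conicalʳ _ _ p)

⋁Θ-mono : ∀ {n} (σ : Subst) {X Y : SubΘ n} → (∀ t → X t ≡ true → Y t ≡ true) →
          ⊢S4 (sub σ (⋁Θ X)) → ⊢S4 (sub σ (⋁Θ Y))
⋁Θ-mono σ {X} {Y} X⊆Y = consequence σ (⋁Θ X) (⋁Θ Y) λ v b p →
  trans (⋁Θ-eval v b Y) (X⊆Y (profile v b) (trans (sym (⋁Θ-eval v b X)) p))

⋁Θ-∪-eval : ∀ {n} (X Y : SubΘ n) v b → eval v b (⋁Θ X ∨' ⋁Θ Y) ≡ eval v b (⋁Θ (X ∪ Y))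
⋁Θ-∪-eval X Y v b
  rewrite ⋁Θ-eval v b X | ⋁Θ-eval v b Y | ⋁Θ-eval v b (X ∪ Y) = refl

⋁Θ-∪-join : ∀ {n} (σ : Subst) (X Y : SubΘ n) →
            ⊢S4 (sub σ (⋁Θ X ∨' ⋁Θ Y)) → ⊢S4 (sub σ (⋁Θ (X ∪ Y)))
⋁Θ-∪-join σ X Y = consequence σ (⋁Θ X ∨' ⋁Θ Y) (⋁Θ (X ∪ Y))
  λ v b p → trans (sym (⋁Θ-∪-eval X Y v b)) p

⋁Θ-∪-split : ∀ {n} (σ : Subst) (X Y : SubΘ n) →
             ⊢S4 (sub σ (⋁Θ (X ∪ Y))) → ⊢S4 (sub σ (⋁Θ X ∨' ⋁Θ Y))
⋁Θ-∪-split σ X Y = consequence σ (⋁Θ (X ∪ Y)) (⋁Θ X ∨' ⋁Θ Y)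
  λ v b p → trans (⋁Θ-∪-eval X Y v b) p

⋁Θ-⋂ : ∀ {n} m (σ : Subst) (X : Fin m → SubΘ n) →
       (∀ k → ⊢S4 (sub σ (⋁Θ (X k)))) → ⊢S4 (sub σ (⋁Θ (⋂ m X)))
⋁Θ-⋂ zero σ X h = taut (taut-sub σ (⋁Θ (⋂ zero X)) (valid (⋁Θ (⋂ zero X)) all-true))
  where
  all-true : ∀ v b → eval v b (⋁Θ (⋂ zero X)) ≡ true
  all-true v b = ⋁Θ-eval v b (⋂ zero X)
⋁Θ-⋂ (suc m) σ X h =
  consequence₂ σ (⋁Θ (X Fin.zero)) (⋁Θ (⋂ m (λ k → X (Fin.suc k)))) (⋁Θ (⋂ (suc m) X)) meet
    (h Fin.zero) (⋁Θ-⋂ m σ (λ k → X (Fin.suc k)) (λ k → h (Fin.suc k)))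
  where
  meet : ∀ v b → eval v b (⋁Θ (X Fin.zero)) ≡ true →
         eval v b (⋁Θ (⋂ m (λ k → X (Fin.suc k)))) ≡ true →
         eval v b (⋁Θ (⋂ (suc m) X)) ≡ true
  meet v b p q
    rewrite ⋁Θ-eval v b (X Fin.zero) | ⋁Θ-eval v b (⋂ m (λ k → X (Fin.suc k)))
          | ⋁Θ-eval v b (⋂ (suc m) X) | p | q = refl

theorem3p9 : (n m : ℕ) (I J : Fin m → SubΘ n) (σ : Subst) →
    ((k : Fin m) → Rejects σ (⋁Θ (I k) ∨' ⋁Θ (J k)) (⋁Θ (J k)))
    ⇔ Σ (SubΘ n) (λ W →
        ((k : Fin m) (t : Idx n) → W t ≡ true → (I k t ∨ J k t) ≡ true)
        × ((k : Fin m) → Rejects σ (⋁Θ W) (⋁Θ (J k))))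
theorem3p9 n m I J σ = mk⇔ narrow widen
  where
  U : Fin m → SubΘ n
  U k = I k ∪ J k

  narrow : ((k : Fin m) → Rejects σ (⋁Θ (I k) ∨' ⋁Θ (J k)) (⋁Θ (J k))) →
           Σ (SubΘ n) (λ W → ((k : Fin m) (t : Idx n) → W t ≡ true → U k t ≡ true)
                             × ((k : Fin m) → Rejects σ (⋁Θ W) (⋁Θ (J k))))
  narrow rejects = ⋂ m U , ⋂-lower m U
                 , λ k → ⋁Θ-⋂ m σ U (λ j → ⋁Θ-∪-join σ (I j) (J j) (proj₁ (rejects j)))
                         , proj₂ (rejects k)

  widen : Σ (SubΘ n) (λ W → ((k : Fin m) (t : Idx n) → W t ≡ true → U k t ≡ true)
                            × ((k : Fin m) → Rejects σ (⋁Θ W) (⋁Θ (J k)))) →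
          (k : Fin m) → Rejects σ (⋁Θ (I k) ∨' ⋁Θ (J k)) (⋁Θ (J k))
  widen (W , W⊆U , rejects) k =
    ⋁Θ-∪-split σ (I k) (J k) (⋁Θ-mono σ (W⊆U k) (proj₁ (rejects k))) , proj₂ (rejects k)
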